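{- For all positive integers $m$ and $t$, \[ \sum_{k=1}^{t}(-1)^{k-1}\frac{b^k q^{\frac{k(k+1)}{2}+(m-1)k}}{(1-q^k)^m}\begin{bmatrix} t\\ k\end{bmatrix}_{q,b} =\sum_{j_1=1}^{t}\frac{b^{j_1}q^{j_1}}{1-q^{j_1}}\sum_{j_2=1}^{j_1}\frac{q^{j_2}}{1-q^{j_2}}\cdots\sum_{j_m=1}^{j_{m-1}}\frac{q^{j_m}}{1-q^{j_m}}, \] where \[ \begin{bmatrix} t\\ k\end{bmatrix}_{q,b}:=\sum_{\substack{\lambda\text{ partition},\ \lambda_1\le t-k,\ \ell(\lambda)\le k}} b^{\lambda_1}q^{|\lambda|}. \]
   Context: A partition $\lambda=(\lambda_1,\dots,\lambda_\ell)$ is a finite weakly decreasing sequence of positive integers (including the empty partition, with $\lambda_1:=0$, $\ell=0$, $|\lambda|=0$); $\ell(\lambda)=\ell$ is its length and $|\lambda|=\sum_i\lambda_i$. $b$ and $q$ are indeterminates; identities are of formal power series in $q$. When $b=1$, $\begin{bmatrix} t\\ k\end{bmatrix}_{q,1}$ is the ordinary $q$-binomial coefficient. -}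

module Defs where

open import Data.Nat as ℕ using (ℕ; zero; suc; _∸_; _≟_)
open import Data.Nat.Divisibility using (_∣?_)
open import Data.Nat.DivMod using (_/_)
open import Data.Integer as ℤ using (ℤ; +_; -_)
open import Data.Bool using (Bool; true; false; _∧_; if_then_else_)
open import Data.List using (List; []; _∷_; map; concatMap; upTo; filter; foldr)
open import Relation.Nullary.Decidable using (does)
open import Relation.Binary.PropositionalEquality using (_≡_)

-- Formal power series in two commuting indeterminates b and q with
-- integer coefficients:  f i n  is the coefficient of  b^i q^n.
-- (Both sides of the identity lie in ℤ[b][[q]] ⊆ ℤ[[b,q]].)

Series : Set
Series = ℕ → ℕ → ℤ

_≈S_ : Series → Series → Set
f ≈S g = ∀ i n → f i n ≡ g i n

infix 4 _≈S_

zeroS : Series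
zeroS _ _ = + 0

mono : ℤ → ℕ → ℕ → Series
mono c a e i n = if does (i ≟ a) ∧ does (n ≟ e) then c else + 0

oneS : Series
oneS = mono (+ 1) 0 0

_+S_ : Series → Series → Series
(f +S g) i n = f i n ℤ.+ g i n

negS : Series → Series
negS f i n = - f i n

sumℤ : List ℤ → ℤ
sumℤ = foldr ℤ._+_ (+ 0)

_*S_ : Series → Series → Series
(f *S g) i n =
  sumℤ (concatMap (λ i₁ → map (λ n₁ → f i₁ n₁ ℤ.* g (i ∸ i₁) (n ∸ n₁))
                               (upTo (suc n)))
                  (upTo (suc i)))

infixl 6 _+S_
infixl 7 _*S_

_^S_ : Series → ℕ → Series
f ^S zero    = oneS
f ^S (suc m) = f *S (f ^S m)

signS : ℕ → Series
signS zero    = oneS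
signS (suc e) = negS (signS e)

ΣS : List ℕ → (ℕ → Series) → Series
ΣS ks F = foldr (λ k acc → F k +S acc) zeroS ks

range1 : ℕ → List ℕ
range1 t = map suc (upTo t)

-- 1/(1-q^k) (for k ≥ 1): the geometric series Σ_{j≥0} q^{kj},
-- i.e. coefficient 1 at b^0 q^n exactly when k ∣ n.
geomInv : ℕ → Series
geomInv k i n = if does (i ≟ 0) ∧ does (k ∣? n) then + 1 else + 0

decreasing : List ℕ → Bool
decreasing []           = true
decreasing (x ∷ [])     = true
decreasing (x ∷ y ∷ xs) = does (y ℕ.≤? x) ∧ decreasing (y ∷ xs)

allPositive : List ℕ → Bool
allPositive []       = true
allPositive (x ∷ xs) = does (1 ℕ.≤? x) ∧ allPositive xs

isPartition : List ℕ → Bool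
isPartition λs = decreasing λs ∧ allPositive λs

largestPart : List ℕ → ℕ
largestPart []      = 0
largestPart (x ∷ _) = x

size : List ℕ → ℕ
size = foldr ℕ._+_ 0

-- all lists of length ≤ L with entries in {0,…,a} (each exactly once)
boundedLists : ℕ → ℕ → List (List ℕ)
boundedLists a zero    = [] ∷ []
boundedLists a (suc L) =
  [] ∷ concatMap (λ x → map (x ∷_) (boundedLists a L)) (upTo (suc a))

boxPartitions : ℕ → ℕ → List (List ℕ)
boxPartitions a L = filter (λ λs → isPartition λs ≡? true) (boundedLists a L)
  where
    open import Data.Bool.Properties using () renaming (_≟_ to _≡?_)

qbBinom : ℕ → ℕ → Series
qbBinom t k =
  foldr (λ λs acc → mono (+ 1) (largestPart λs) (size λs) +S acc) zeroS
        (boxPartitions (t ∸ k) k)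

tri : ℕ → ℕ
tri k = (k ℕ.* suc k) / 2

LHS : ℕ → ℕ → Series
LHS m t = ΣS (range1 t) λ k →
  signS (k ∸ 1)
  *S mono (+ 1) k (tri k ℕ.+ (m ∸ 1) ℕ.* k)
  *S (geomInv k ^S m)
  *S qbBinom t k

nested : ℕ → ℕ → Series
nested zero    j = oneS
nested (suc r) j = ΣS (range1 j) λ i → mono (+ 1) 0 i *S geomInv i *S nested r i

RHS : ℕ → ℕ → Series
RHS m t = ΣS (range1 t) λ j₁ →
  mono (+ 1) j₁ j₁ *S geomInv j₁ *S nested (m ∸ 1) j₁

module Submission where

-- Both sides vanish at t = 0, so we compare their increments from t to t+1.
-- Widening the box defining [t,k]_{q,b} by one column adds the partitions with
-- largest part t+1-k, counted by b^{t+1-k} q^{t+1-k} times a Gaussian polynomial;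
-- so the left side grows by b^{t+1} q^t alt(m, t+1), where
--   alt(m, s) = Σ_{j<s} (-1)^j q^{C(j,2)} (q^{j+1}/(1-q^{j+1}))^m [s-1, j]_q.
-- The right side grows by b^{t+1} q^{t+1}/(1-q^{t+1}) · nested(m-1, t+1), and the
-- closed form  alt(m, s) = q/(1-q^s) · nested(m-1, s)  follows by induction from
-- alt(0, s) = 0 (the q-binomial theorem at x = 1) and the recurrence
--   (1-q^{s+1}) alt(m+1, s+1) - q^{s+1} alt(m, s+1) = (1-q^s) alt(m+1, s),
-- a consequence of the q-Pascal rules.

open import Defs
open import Data.Nat using (ℕ; _≤_)

open import Algebra using (CommutativeRing)
open import Algebra.Structures using (IsCommutativeRing)
open import Algebra.Solver.Ring.AlmostCommutativeRing using (fromCommutativeRing; _-Raw-AlmostCommutative⟶_)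
open import Data.Bool using (Bool; true; false; _∧_; if_then_else_)
open import Data.Bool.Properties using (∧-zeroʳ)
import Data.Bool.Properties as BoolP
open import Data.Integer as ℤ using (ℤ; +_)
import Data.Integer.Properties as ℤP
open import Data.List using (List; []; _∷_; _++_; map; concatMap; foldr; filter; upTo; applyUpTo)
open import Data.Maybe using (Maybe; just; nothing)
open import Data.Nat as ℕ using (zero; suc; _∸_; _<_; s≤s; z≤n)
import Data.Nat.Properties as ℕP
open import Data.Nat.Divisibility using (_∣_; _∣?_; ∣m∸n∣n⇒∣m; ∣m+n∣m⇒∣n; ∣-refl; _∣0; ∣⇒≤)
open import Data.Nat.DivMod using (m*n/n≡m)
open import Data.Nat.Tactic.RingSolver using (solve-∀)
open import Data.Product using (_,_; proj₁; proj₂)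
open import Function using (_∘_)
open import Level using (0ℓ)
open import Function.Bundles using (_⇔_; mk⇔)
open import Relation.Nullary using (yes; no)
open import Relation.Nullary.Decidable using (does; dec-true; dec-false; does-⇔)
open import Relation.Binary.PropositionalEquality as P using (_≡_; _≢_)

module FiniteSums {c ℓ} (R : CommutativeRing c ℓ) where

  open CommutativeRing R
  open import Relation.Binary.Reasoning.Setoid setoid
  open import Algebra.Solver.Ring.NaturalCoefficients.Default commutativeSemiring

  Σ : ℕ → (ℕ → Carrier) → Carrier
  Σ zero    h = 0#
  Σ (suc N) h = h 0 + Σ N (h ∘ suc)

  Σ-cong : ∀ N {h k : ℕ → Carrier} → (∀ a → a < N → h a ≈ k a) → Σ N h ≈ Σ N k
  Σ-cong zero    e = refl
  Σ-cong (suc N) e = +-cong (e 0 (s≤s z≤n)) (Σ-cong N (λ a a<N → e (suc a) (s≤s a<N)))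

  Σ-+ : ∀ N h k → Σ N (λ a → h a + k a) ≈ Σ N h + Σ N k
  Σ-+ zero    h k = sym (+-identityˡ 0#)
  Σ-+ (suc N) h k = begin
    (h 0 + k 0) + Σ N (λ a → h (suc a) + k (suc a))
      ≈⟨ +-congˡ (Σ-+ N (h ∘ suc) (k ∘ suc)) ⟩
    (h 0 + k 0) + (Σ N (h ∘ suc) + Σ N (k ∘ suc))
      ≈⟨ solve 4 (λ a b c d → (a :+ b) :+ (c :+ d) := (a :+ c) :+ (b :+ d)) refl
               (h 0) (k 0) (Σ N (h ∘ suc)) (Σ N (k ∘ suc)) ⟩
    (h 0 + Σ N (h ∘ suc)) + (k 0 + Σ N (k ∘ suc)) ∎

  Σ-*ˡ : ∀ N x h → x * Σ N h ≈ Σ N (λ a → x * h a)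
  Σ-*ˡ zero    x h = zeroʳ x
  Σ-*ˡ (suc N) x h = trans (distribˡ x (h 0) _) (+-congˡ (Σ-*ˡ N x (h ∘ suc)))

  Σ-0 : ∀ N h → (∀ a → a < N → h a ≈ 0#) → Σ N h ≈ 0#
  Σ-0 zero    h e = refl
  Σ-0 (suc N) h e = trans (+-cong (e 0 (s≤s z≤n)) (Σ-0 N (h ∘ suc) (λ a a<N → e (suc a) (s≤s a<N))))
                          (+-identityˡ 0#)

  Σ-single : ∀ N a h → a < N → (∀ x → x < N → x ≢ a → h x ≈ 0#) → Σ N h ≈ h a
  Σ-single (suc N) zero h _ e =
    trans (+-congˡ (Σ-0 N (h ∘ suc) (λ x x<N → e (suc x) (s≤s x<N) (λ ()))))
          (+-identityʳ (h 0))
  Σ-single (suc N) (suc a) h (s≤s a<N) e =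
    trans (+-congʳ (e 0 (s≤s z≤n) (λ ())))
      (trans (+-identityˡ _)
        (Σ-single N a (h ∘ suc) a<N (λ x x<N x≢a → e (suc x) (s≤s x<N) (x≢a ∘ ℕP.suc-injective))))

  Σ-truncate : ∀ N M {h h′ : ℕ → Carrier} → M ≤ N → (∀ y → y < M → h′ y ≈ h y) →
               (∀ y → M ≤ y → h′ y ≈ 0#) → Σ N h′ ≈ Σ M h
  Σ-truncate N       zero    _ _ vanish = Σ-0 N _ (λ y _ → vanish y z≤n)
  Σ-truncate (suc N) (suc M) (s≤s M≤N) agree vanish =
    +-cong (agree 0 (s≤s z≤n))
           (Σ-truncate N M M≤N (λ y y<M → agree (suc y) (s≤s y<M)) (λ y M≤y → vanish (suc y) (s≤s M≤y)))

  Σ-last : ∀ N h → Σ (suc N) h ≈ Σ N h + h N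
  Σ-last zero    h = trans (+-identityʳ (h 0)) (sym (+-identityˡ (h 0)))
  Σ-last (suc N) h = trans (+-congˡ (Σ-last N (h ∘ suc))) (sym (+-assoc _ _ _))

  telescope : ∀ N (f : ℕ → Carrier) → Σ N (λ i → f i - f (suc i)) ≈ f 0 - f N
  telescope zero    f = sym (-‿inverseʳ (f 0))
  telescope (suc N) f = begin
    (f 0 - f 1) + Σ N (λ i → f (suc i) - f (suc (suc i)))  ≈⟨ +-congˡ (telescope N (f ∘ suc)) ⟩
    (f 0 - f 1) + (f 1 - f (suc N))                        ≈⟨ +-assoc (f 0) (- f 1) _ ⟩
    f 0 + (- f 1 + (f 1 - f (suc N)))                      ≈⟨ +-congˡ (sym (+-assoc (- f 1) (f 1) _)) ⟩
    f 0 + ((- f 1 + f 1) - f (suc N))                      ≈⟨ +-congˡ (+-congʳ (-‿inverseˡ (f 1))) ⟩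
    f 0 + (0# - f (suc N))                                 ≈⟨ +-congˡ (+-identityˡ _) ⟩
    f 0 - f (suc N)                                        ∎

  Σ-linear : ∀ N c c′ h h′ → c * Σ N h - c′ * Σ N h′ ≈ Σ N (λ j → c * h j - c′ * h′ j)
  Σ-linear N c c′ h h′ = begin
    c * Σ N h - c′ * Σ N h′                          ≈⟨ +-congˡ (-‿distribˡ-* c′ (Σ N h′)) ⟩
    c * Σ N h + (- c′) * Σ N h′                      ≈⟨ +-cong (Σ-*ˡ N c h) (Σ-*ˡ N (- c′) h′) ⟩
    Σ N (λ j → c * h j) + Σ N (λ j → (- c′) * h′ j) ≈⟨ sym (Σ-+ N (λ j → c * h j) (λ j → (- c′) * h′ j)) ⟩
    Σ N (λ j → c * h j + (- c′) * h′ j)             ≈⟨ Σ-cong N (λ j _ → +-congˡ (sym (-‿distribˡ-* c′ (h′ j)))) ⟩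
    Σ N (λ j → c * h j - c′ * h′ j)                 ∎
    where open import Algebra.Properties.Ring ring using (-‿distribˡ-*)

  sumOver : ∀ {a} {A : Set a} → (A → Carrier) → List A → Carrier
  sumOver F = foldr (λ x acc → F x + acc) 0#

  sumOver-cong : ∀ {a} {A : Set a} {F G : A → Carrier} xs → (∀ x → F x ≈ G x) → sumOver F xs ≈ sumOver G xs
  sumOver-cong []       e = refl
  sumOver-cong (x ∷ xs) e = +-cong (e x) (sumOver-cong xs e)

  sumOver-0 : ∀ {a} {A : Set a} (F : A → Carrier) xs → (∀ x → F x ≈ 0#) → sumOver F xs ≈ 0#
  sumOver-0 F []       e = refl
  sumOver-0 F (x ∷ xs) e = trans (+-cong (e x) (sumOver-0 F xs e)) (+-identityˡ 0#)

  sumOver-*ˡ : ∀ {a} {A : Set a} c (F : A → Carrier) xs → c * sumOver F xs ≈ sumOver (λ x → c * F x) xs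
  sumOver-*ˡ c F []       = zeroʳ c
  sumOver-*ˡ c F (x ∷ xs) = trans (distribˡ c (F x) (sumOver F xs)) (+-congˡ (sumOver-*ˡ c F xs))

  sumOver-++ : ∀ {a} {A : Set a} (F : A → Carrier) xs ys → sumOver F (xs ++ ys) ≈ sumOver F xs + sumOver F ys
  sumOver-++ F []       ys = sym (+-identityˡ _)
  sumOver-++ F (x ∷ xs) ys = trans (+-congˡ (sumOver-++ F xs ys)) (sym (+-assoc (F x) _ _))

  sumOver-concatMap : ∀ {a b} {A : Set a} {B : Set b} (F : B → Carrier) (h : A → List B) xs →
                      sumOver F (concatMap h xs) ≈ sumOver (sumOver F ∘ h) xs
  sumOver-concatMap F h []       = refl
  sumOver-concatMap F h (x ∷ xs) = trans (sumOver-++ F (h x) _) (+-congˡ (sumOver-concatMap F h xs))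

  sumOver-map : ∀ {a b} {A : Set a} {B : Set b} (F : B → Carrier) (f : A → B) xs →
                sumOver F (map f xs) ≡ sumOver (F ∘ f) xs
  sumOver-map F f []       = P.refl
  sumOver-map F f (x ∷ xs) = P.cong (λ w → F (f x) + w) (sumOver-map F f xs)

  sumOver-applyUpTo : ∀ F (f : ℕ → ℕ) N → sumOver F (applyUpTo f N) ≡ Σ N (F ∘ f)
  sumOver-applyUpTo F f zero    = P.refl
  sumOver-applyUpTo F f (suc N) = P.cong (λ w → F (f 0) + w) (sumOver-applyUpTo F (f ∘ suc) N)

-- Iterating this
-- construction twice over ℤ gives the series ring of Defs.
module PowerSeries {c ℓ} (R : CommutativeRing c ℓ) where

  open CommutativeRing R
  open FiniteSums R
  open import Relation.Binary.Reasoning.Setoid setoid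
  open import Algebra.Solver.Ring.NaturalCoefficients.Default commutativeSemiring

  PS : Set c
  PS = ℕ → Carrier

  _≈P_ : PS → PS → Set ℓ
  f ≈P g = ∀ n → f n ≈ g n

  _⊕_ : PS → PS → PS
  (f ⊕ g) n = f n + g n

  ⊖_ : PS → PS
  (⊖ f) n = - f n

  zeroP : PS
  zeroP _ = 0#

  oneP : PS
  oneP zero    = 1#
  oneP (suc _) = 0#

  _⊛_ : PS → PS → PS
  (f ⊛ g) n = Σ (suc n) (λ a → f a * g (n ∸ a))

  ⊛-cong : ∀ {f f′ g g′} → f ≈P f′ → g ≈P g′ → (f ⊛ g) ≈P (f′ ⊛ g′)
  ⊛-cong {f} {f′} {g} {g′} ef eg n =
    Σ-cong (suc n) {λ a → f a * g (n ∸ a)} (λ a _ → *-cong (ef a) (eg (n ∸ a)))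

  ⊛-suc : ∀ f g n → (f ⊛ g) (suc n) ≈ (f ⊛ (g ∘ suc)) n + f (suc n) * g 0
  ⊛-suc f g n = trans (Σ-last (suc n) (λ a → f a * g (suc n ∸ a)))
    (+-cong (Σ-cong (suc n) (λ a a<1+n → reflexive
                (P.cong (λ w → f a * g w) (ℕP.+-∸-assoc 1 (ℕP.≤-pred a<1+n)))))
            (reflexive (P.cong (λ w → f (suc n) * g w) (ℕP.n∸n≡0 n))))

  ⊛-distribʳ : ∀ f f′ g n → ((f ⊕ f′) ⊛ g) n ≈ (f ⊛ g) n + (f′ ⊛ g) n
  ⊛-distribʳ f f′ g n = trans
    (Σ-cong (suc n) {λ a → (f a + f′ a) * g (n ∸ a)} (λ a _ → distribʳ (g (n ∸ a)) (f a) (f′ a)))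
    (Σ-+ (suc n) (λ a → f a * g (n ∸ a)) (λ a → f′ a * g (n ∸ a)))

  ⊛-distribˡ : ∀ f g g′ n → (f ⊛ (g ⊕ g′)) n ≈ (f ⊛ g) n + (f ⊛ g′) n
  ⊛-distribˡ f g g′ n = trans
    (Σ-cong (suc n) {λ a → f a * (g (n ∸ a) + g′ (n ∸ a))} (λ a _ → distribˡ (f a) (g (n ∸ a)) (g′ (n ∸ a))))
    (Σ-+ (suc n) (λ a → f a * g (n ∸ a)) (λ a → f a * g′ (n ∸ a)))

  ⊛-scalar : ∀ x f g n → ((λ k → x * f k) ⊛ g) n ≈ x * (f ⊛ g) n
  ⊛-scalar x f g n = sym (trans (Σ-*ˡ (suc n) x (λ a → f a * g (n ∸ a)))
    (Σ-cong (suc n) {λ a → x * (f a * g (n ∸ a))} (λ a _ → sym (*-assoc x (f a) (g (n ∸ a))))))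

  ⊛-comm : ∀ n f g → (f ⊛ g) n ≈ (g ⊛ f) n
  ⊛-comm zero    f g = +-congʳ (*-comm (f 0) (g 0))
  ⊛-comm (suc n) f g = begin
    f 0 * g (suc n) + ((f ∘ suc) ⊛ g) n ≈⟨ +-congˡ (⊛-comm n (f ∘ suc) g) ⟩
    f 0 * g (suc n) + (g ⊛ (f ∘ suc)) n ≈⟨ +-comm _ _ ⟩
    (g ⊛ (f ∘ suc)) n + f 0 * g (suc n) ≈⟨ +-congˡ (*-comm _ _) ⟩
    (g ⊛ (f ∘ suc)) n + g (suc n) * f 0 ≈⟨ sym (⊛-suc g f n) ⟩
    (g ⊛ f) (suc n) ∎

  ⊛-assoc : ∀ n f g h → ((f ⊛ g) ⊛ h) n ≈ (f ⊛ (g ⊛ h)) n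
  ⊛-assoc zero f g h = +-congʳ (trans (*-congʳ (+-identityʳ _))
                         (trans (*-assoc _ _ _) (*-congˡ (sym (+-identityʳ _)))))
  ⊛-assoc (suc n) f g h = begin
    (f ⊛ g) 0 * h (suc n) + (((f ⊛ g) ∘ suc) ⊛ h) n
      ≈⟨ +-congˡ (⊛-distribʳ (λ k → f 0 * g (suc k)) ((f ∘ suc) ⊛ g) h n) ⟩
    (f ⊛ g) 0 * h (suc n) + (((λ k → f 0 * g (suc k)) ⊛ h) n + (((f ∘ suc) ⊛ g) ⊛ h) n)
      ≈⟨ +-cong (*-congʳ (+-identityʳ _))
                (+-cong (⊛-scalar (f 0) (g ∘ suc) h n) (⊛-assoc n (f ∘ suc) g h)) ⟩
    (f 0 * g 0) * h (suc n) + (f 0 * ((g ∘ suc) ⊛ h) n + ((f ∘ suc) ⊛ (g ⊛ h)) n)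
      ≈⟨ solve 5 (λ a b c x y → (a :* b) :* c :+ (a :* x :+ y) := a :* (b :* c :+ x) :+ y) refl
               (f 0) (g 0) (h (suc n)) (((g ∘ suc) ⊛ h) n) (((f ∘ suc) ⊛ (g ⊛ h)) n) ⟩
    f 0 * (g 0 * h (suc n) + ((g ∘ suc) ⊛ h) n) + ((f ∘ suc) ⊛ (g ⊛ h)) n ∎

  ⊛-identityˡ : ∀ g n → (oneP ⊛ g) n ≈ g n
  ⊛-identityˡ g zero    = trans (+-identityʳ _) (*-identityˡ _)
  ⊛-identityˡ g (suc n) =
    trans (+-cong (*-identityˡ _) (Σ-0 (suc n) (λ a → 0# * g (n ∸ a)) (λ a _ → zeroˡ _)))
          (+-identityʳ _)

  isCommutativeRingP : IsCommutativeRing _≈P_ _⊕_ _⊛_ ⊖_ zeroP oneP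
  isCommutativeRingP = record
    { isRing = record
      { +-isAbelianGroup = record
        { isGroup = record
          { isMonoid = record
            { isSemigroup = record
              { isMagma = record
                { isEquivalence = record
                  { refl = λ _ → refl ; sym = λ e n → sym (e n) ; trans = λ e e′ n → trans (e n) (e′ n) }
                ; ∙-cong = λ e e′ n → +-cong (e n) (e′ n) }
              ; assoc = λ f g h n → +-assoc (f n) (g n) (h n) }
            ; identity = (λ f n → +-identityˡ (f n)) , (λ f n → +-identityʳ (f n)) }
          ; inverse = (λ f n → -‿inverseˡ (f n)) , (λ f n → -‿inverseʳ (f n))
          ; ⁻¹-cong = λ e n → -‿cong (e n) }
        ; comm = λ f g n → +-comm (f n) (g n) }
      ; *-cong = ⊛-cong
      ; *-assoc = λ f g h n → ⊛-assoc n f g h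
      ; *-identity = (λ f n → ⊛-identityˡ f n)
                   , (λ f n → trans (⊛-comm n f oneP) (⊛-identityˡ f n))
      ; distrib = (λ f g h n → ⊛-distribˡ f g h n) , (λ h f g n → ⊛-distribʳ f g h n) }
    ; *-comm = λ f g n → ⊛-comm n f g }

  powerSeriesRing : CommutativeRing c ℓ
  powerSeriesRing = record { isCommutativeRing = isCommutativeRingP }

-- ℤ[[q]] and the ring of power series in b over it; the latter has
-- carrier ℕ → ℕ → ℤ = Series.
module ℤ[[q]]    = PowerSeries ℤP.+-*-commutativeRing
module ℤ[[q]][[b]] = PowerSeries ℤ[[q]].powerSeriesRing
module Σℤ = FiniteSums ℤP.+-*-commutativeRing

sumℤ-upTo : ∀ (h : ℕ → ℤ) N → sumℤ (map h (upTo N)) ≡ Σℤ.Σ N h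
sumℤ-upTo h N = P.trans (Σℤ.sumOver-map (λ x → x) h (upTo N)) (Σℤ.sumOver-applyUpTo h (λ x → x) N)

*S-coeff : ∀ f g i n → (f *S g) i n ≡ Σℤ.Σ (suc i) (λ x → Σℤ.Σ (suc n) (λ y → f x y ℤ.* g (i ∸ x) (n ∸ y)))
*S-coeff f g i n = begin
  sumℤ (concatMap row (upTo (suc i)))     ≡⟨ Σℤ.sumOver-concatMap (λ x → x) row (upTo (suc i)) ⟩
  Σℤ.sumOver (sumℤ ∘ row) (upTo (suc i))  ≡⟨ Σℤ.sumOver-applyUpTo (sumℤ ∘ row) (λ x → x) (suc i) ⟩
  Σℤ.Σ (suc i) (sumℤ ∘ row)               ≡⟨ Σℤ.Σ-cong (suc i) (λ x _ → sumℤ-upTo (term x) (suc n)) ⟩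
  Σℤ.Σ (suc i) (λ x → Σℤ.Σ (suc n) (term x)) ∎
  where
    open P.≡-Reasoning
    term : ℕ → ℕ → ℤ
    term x y = f x y ℤ.* g (i ∸ x) (n ∸ y)
    row : ℕ → List ℤ
    row x = map (term x) (upTo (suc n))

*S≈⊛ : ∀ f g → (f *S g) ≈S ℤ[[q]][[b]]._⊛_ f g
*S≈⊛ f g i n = P.trans (*S-coeff f g i n) (P.sym (Σ-at (suc i) (λ x → ℤ[[q]]._⊛_ (f x) (g (i ∸ x)))))
  where
    Σ-at : ∀ N (h : ℕ → ℕ → ℤ) → FiniteSums.Σ ℤ[[q]].powerSeriesRing N h n ≡ Σℤ.Σ N (λ a → h a n)
    Σ-at zero    h = P.refl
    Σ-at (suc N) h = P.cong (λ w → h 0 n ℤ.+ w) (Σ-at N (h ∘ suc))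

mono-off₁ : ∀ c a e x y → x ≢ a → mono c a e x y ≡ + 0
mono-off₁ c a e x y x≢a = P.cong (λ β → if β ∧ does (y ℕP.≟ e) then c else + 0) (dec-false (x ℕP.≟ a) x≢a)

mono-off₂ : ∀ c a e x y → y ≢ e → mono c a e x y ≡ + 0
mono-off₂ c a e x y y≢e with does (x ℕP.≟ a)
... | true  = P.cong (λ β → if β then c else + 0) (dec-false (y ℕP.≟ e) y≢e)
... | false = P.refl

mono-at : ∀ c a e → mono c a e a e ≡ c
mono-at c a e = P.cong₂ (λ β β′ → if β ∧ β′ then c else + 0) (dec-true (a ℕP.≟ a) P.refl) (dec-true (e ℕP.≟ e) P.refl)

mono-+ : ∀ c d a e → mono (c ℤ.+ d) a e ≈S (mono c a e +S mono d a e)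
mono-+ c d a e x y with does (x ℕP.≟ a) ∧ does (y ℕP.≟ e)
... | true  = P.refl
... | false = P.refl

mono-neg : ∀ c a e → mono (ℤ.- c) a e ≈S negS (mono c a e)
mono-neg c a e x y with does (x ℕP.≟ a) ∧ does (y ℕP.≟ e)
... | true  = P.refl
... | false = P.refl

mono-0 : ∀ a e → mono (+ 0) a e ≈S zeroS
mono-0 a e x y with does (x ℕP.≟ a) ∧ does (y ℕP.≟ e)
... | true  = P.refl
... | false = P.refl

mono-scale : ∀ c d a e x y → c ℤ.* mono d a e x y ≡ mono (c ℤ.* d) a e x y
mono-scale c d a e x y with does (x ℕP.≟ a) ∧ does (y ℕP.≟ e)
... | true  = P.refl
... | false = ℤP.*-zeroʳ c

mono-shift : ∀ r {a e a′ e′ i n} → a ≤ i → e ≤ n → mono r a′ e′ (i ∸ a) (n ∸ e) ≡ mono r (a ℕ.+ a′) (e ℕ.+ e′) i n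
mono-shift r {a} {e} {a′} {e′} {i} {n} a≤i e≤n =
  P.cong₂ (λ β β′ → if β ∧ β′ then r else + 0) (does-⇔ (∸≡⇔ a≤i) ((i ∸ a) ℕP.≟ a′) (i ℕP.≟ a ℕ.+ a′))
                                                   (does-⇔ (∸≡⇔ e≤n) ((n ∸ e) ℕP.≟ e′) (n ℕP.≟ e ℕ.+ e′))
  where
    ∸≡⇔ : ∀ {u v w} → u ≤ v → (v ∸ u ≡ w) ⇔ (v ≡ u ℕ.+ w)
    ∸≡⇔ {u} {v} {w} u≤v = mk⇔
      (λ eq → P.trans (P.sym (ℕP.m+[n∸m]≡n u≤v)) (P.cong (λ x → u ℕ.+ x) eq))
      (λ eq → P.trans (P.cong (_∸ u) eq) (ℕP.m+n∸m≡n u w))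

mono-*-in : ∀ c a e f i n → a ≤ i → e ≤ n → (mono c a e *S f) i n ≡ c ℤ.* f (i ∸ a) (n ∸ e)
mono-*-in c a e f i n a≤i e≤n = begin
  (mono c a e *S f) i n                                    ≡⟨ *S-coeff (mono c a e) f i n ⟩
  Σℤ.Σ (suc i) (λ x → Σℤ.Σ (suc n) (term x))               ≡⟨ Σℤ.Σ-single (suc i) a _ (s≤s a≤i) row-off ⟩
  Σℤ.Σ (suc n) (term a)                                    ≡⟨ Σℤ.Σ-single (suc n) e _ (s≤s e≤n) col-off ⟩
  mono c a e a e ℤ.* f (i ∸ a) (n ∸ e)                     ≡⟨ P.cong (ℤ._* f (i ∸ a) (n ∸ e)) (mono-at c a e) ⟩
  c ℤ.* f (i ∸ a) (n ∸ e) ∎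
  where
    open P.≡-Reasoning
    term : ℕ → ℕ → ℤ
    term x y = mono c a e x y ℤ.* f (i ∸ x) (n ∸ y)
    row-off : ∀ x → x < suc i → x ≢ a → Σℤ.Σ (suc n) (term x) ≡ + 0
    row-off x _ x≢a = Σℤ.Σ-0 (suc n) (term x) (λ y _ → P.cong (ℤ._* _) (mono-off₁ c a e x y x≢a))
    col-off : ∀ y → y < suc n → y ≢ e → term a y ≡ + 0
    col-off y _ y≢e = P.cong (ℤ._* _) (mono-off₂ c a e a y y≢e)

mono-*-out₁ : ∀ c a e f i n → i < a → (mono c a e *S f) i n ≡ + 0
mono-*-out₁ c a e f i n i<a = P.trans (*S-coeff (mono c a e) f i n)
  (Σℤ.Σ-0 (suc i) _ (λ x x≤i → Σℤ.Σ-0 (suc n) (term x) (λ y _ → P.cong (ℤ._* f (i ∸ x) (n ∸ y))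
    (mono-off₁ c a e x y (λ x≡a → ℕP.<⇒≱ i<a (P.subst (_≤ i) x≡a (ℕP.≤-pred x≤i)))))))
  where
    term : ℕ → ℕ → ℤ
    term x y = mono c a e x y ℤ.* f (i ∸ x) (n ∸ y)

mono-*-out₂ : ∀ c a e f i n → n < e → (mono c a e *S f) i n ≡ + 0
mono-*-out₂ c a e f i n n<e = P.trans (*S-coeff (mono c a e) f i n)
  (Σℤ.Σ-0 (suc i) _ (λ x _ → Σℤ.Σ-0 (suc n) (term x) (λ y y≤n → P.cong (ℤ._* f (i ∸ x) (n ∸ y))
    (mono-off₂ c a e x y (λ y≡e → ℕP.<⇒≱ n<e (P.subst (_≤ n) y≡e (ℕP.≤-pred y≤n)))))))
  where
    term : ℕ → ℕ → ℤ
    term x y = mono c a e x y ℤ.* f (i ∸ x) (n ∸ y)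

mono-* : ∀ c d a e a′ e′ → (mono c a e *S mono d a′ e′) ≈S mono (c ℤ.* d) (a ℕ.+ a′) (e ℕ.+ e′)
mono-* c d a e a′ e′ i n with a ℕP.≤? i | e ℕP.≤? n
... | no a≰i | _ = P.trans (mono-*-out₁ c a e (mono d a′ e′) i n (ℕP.≰⇒> a≰i))
  (P.sym (mono-off₁ _ _ _ i n (λ i≡ → a≰i (P.subst (a ≤_) (P.sym i≡) (ℕP.m≤m+n a a′)))))
... | yes _ | no e≰n = P.trans (mono-*-out₂ c a e (mono d a′ e′) i n (ℕP.≰⇒> e≰n))
  (P.sym (mono-off₂ _ _ _ i n (λ n≡ → e≰n (P.subst (e ≤_) (P.sym n≡) (ℕP.m≤m+n e e′)))))
... | yes a≤i | yes e≤n = P.trans (mono-*-in c a e (mono d a′ e′) i n a≤i e≤n)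
  (P.trans (mono-scale c d a′ e′ (i ∸ a) (n ∸ e)) (mono-shift (c ℤ.* d) a≤i e≤n))

-- Equality of series wrapped in a record: unlike the Π-type _≈S_ it lets
-- Agda recover both sides from a proof, as setoid reasoning and the ring
-- solver require.
record _≋_ (f g : Series) : Set where
  constructor mk≋
  field get : f ≈S g
open _≋_

infix 4 _≋_

private
  module BQ = CommutativeRing ℤ[[q]][[b]].powerSeriesRing

  infixr 5 _⟨≈⟩_
  _⟨≈⟩_ : ∀ {f g h} → f ≈S g → g ≈S h → f ≈S h
  (e ⟨≈⟩ e′) i n = P.trans (e i n) (e′ i n)

  ≈S-sym : ∀ {f g} → f ≈S g → g ≈S f
  ≈S-sym e i n = P.sym (e i n)

  ⊛≈*S : ∀ f g → ℤ[[q]][[b]]._⊛_ f g ≈S (f *S g)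
  ⊛≈*S f g = ≈S-sym (*S≈⊛ f g)

  oneS≈oneP : oneS ≈S BQ.1#
  oneS≈oneP zero    zero    = P.refl
  oneS≈oneP zero    (suc n) = P.refl
  oneS≈oneP (suc i) n       = P.refl

-- The laws not involving the product are those of ℤ[[q]][[b]] verbatim;
-- the multiplicative ones are transported along  *S≈⊛.
isCommutativeRingS : IsCommutativeRing _≋_ _+S_ _*S_ negS zeroS oneS
isCommutativeRingS = record
  { isRing = record
    { +-isAbelianGroup = record
      { isGroup = record
        { isMonoid = record
          { isSemigroup = record
            { isMagma = record
              { isEquivalence = record
                { refl = mk≋ (λ _ _ → P.refl) ; sym = λ e → mk≋ (≈S-sym (get e))
                ; trans = λ e e′ → mk≋ (get e ⟨≈⟩ get e′) }
              ; ∙-cong = λ e e′ → mk≋ (BQ.+-cong (get e) (get e′)) }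
            ; assoc = λ f g h → mk≋ (BQ.+-assoc f g h) }
          ; identity = (λ f → mk≋ (proj₁ BQ.+-identity f)) , (λ f → mk≋ (proj₂ BQ.+-identity f)) }
        ; inverse = (λ f → mk≋ (proj₁ BQ.-‿inverse f)) , (λ f → mk≋ (proj₂ BQ.-‿inverse f))
        ; ⁻¹-cong = λ e → mk≋ (BQ.-‿cong (get e)) }
      ; comm = λ f g → mk≋ (BQ.+-comm f g) }
    ; *-cong = λ {f} {f′} {g} {g′} e e′ → mk≋
        (*S≈⊛ f g ⟨≈⟩ BQ.*-cong {f} {f′} {g} {g′} (get e) (get e′) ⟨≈⟩ ⊛≈*S f′ g′)
    ; *-assoc = λ f g h → mk≋
        (*S≈⊛ (f *S g) h ⟨≈⟩ BQ.*-cong {f *S g} {_} {h} {h} (*S≈⊛ f g) (λ _ _ → P.refl)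
         ⟨≈⟩ BQ.*-assoc f g h
         ⟨≈⟩ BQ.*-cong {f} {f} {_} {g *S h} (λ _ _ → P.refl) (⊛≈*S g h) ⟨≈⟩ ⊛≈*S f (g *S h))
    ; *-identity = (λ f → mk≋ (*S≈⊛ oneS f ⟨≈⟩ BQ.*-cong {oneS} {BQ.1#} {f} {f} oneS≈oneP (λ _ _ → P.refl)
                              ⟨≈⟩ proj₁ BQ.*-identity f))
                 , (λ f → mk≋ (*S≈⊛ f oneS ⟨≈⟩ BQ.*-cong {f} {f} {oneS} {BQ.1#} (λ _ _ → P.refl) oneS≈oneP
                              ⟨≈⟩ proj₂ BQ.*-identity f))
    ; distrib = (λ f g h → mk≋ (*S≈⊛ f (g +S h) ⟨≈⟩ proj₁ BQ.distrib f g h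
                                ⟨≈⟩ BQ.+-cong (⊛≈*S f g) (⊛≈*S f h)))
              , (λ h f g → mk≋ (*S≈⊛ (f +S g) h ⟨≈⟩ proj₂ BQ.distrib h f g
                                ⟨≈⟩ BQ.+-cong (⊛≈*S f h) (⊛≈*S g h)))
    }
  ; *-comm = λ f g → mk≋ (*S≈⊛ f g ⟨≈⟩ BQ.*-comm f g ⟨≈⟩ ⊛≈*S g f)
  }

seriesRing : CommutativeRing 0ℓ 0ℓ
seriesRing = record { isCommutativeRing = isCommutativeRingS }

-- Integer constants  c ↦ c·b⁰q⁰  form a ring morphism ℤ → Series; this
-- instantiates the ring solver for series with integer coefficients.
const : ℤ → Series
const c = mono c 0 0

constMorphism : CommutativeRing.rawRing ℤP.+-*-commutativeRing -Raw-AlmostCommutative⟶ fromCommutativeRing seriesRing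
constMorphism = record
  { ⟦_⟧    = const
  ; +-homo = λ c d → mk≋ (mono-+ c d 0 0)
  ; *-homo = λ c d → mk≋ (≈S-sym (mono-* c d 0 0 0 0))
  ; -‿homo = λ c → mk≋ (mono-neg c 0 0)
  ; 0-homo = mk≋ (mono-0 0 0)
  ; 1-homo = mk≋ (λ _ _ → P.refl)
  }

const-≟ : ∀ c d → Maybe (const c ≋ const d)
const-≟ c d with c ℤ.≟ d
... | yes P.refl = just (mk≋ (λ _ _ → P.refl))
... | no _     = nothing

open import Algebra.Solver.Ring (CommutativeRing.rawRing ℤP.+-*-commutativeRing)
                                (fromCommutativeRing seriesRing) constMorphism const-≟

open CommutativeRing seriesRing hiding (zero)
open import Relation.Binary.Reasoning.Setoid setoid
module ΣS = FiniteSums seriesRing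
open ΣS using (Σ; sumOver)

-- Congruence steps with the unchanged context given explicitly: series are
-- functions, so Agda cannot infer that context by unification.
infixl 6 _+⟨_⟩ ⟨_⟩+_ _-⟨_⟩
infixl 7 _*⟨_⟩ ⟨_⟩*_

_+⟨_⟩ : ∀ a {x y} → x ≈ y → a + x ≈ a + y
a +⟨ e ⟩ = +-cong (refl {a}) e

⟨_⟩+_ : ∀ {x y} → x ≈ y → ∀ a → x + a ≈ y + a
⟨ e ⟩+ a = +-cong e (refl {a})

_-⟨_⟩ : ∀ a {x y} → x ≈ y → a - x ≈ a - y
a -⟨ e ⟩ = +-cong (refl {a}) (-‿cong e)

_*⟨_⟩ : ∀ a {x y} → x ≈ y → a * x ≈ a * y
a *⟨ e ⟩ = *-cong (refl {a}) e

⟨_⟩*_ : ∀ {x y} → x ≈ y → ∀ a → x * a ≈ y * a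
⟨ e ⟩* a = *-cong e (refl {a})

bq : ℕ → ℕ → Series
bq a e = mono (+ 1) a e

q^ : ℕ → Series
q^ e = bq 0 e

bq-* : ∀ a e a′ e′ → bq a e * bq a′ e′ ≈ bq (a ℕ.+ a′) (e ℕ.+ e′)
bq-* a e a′ e′ = mk≋ (mono-* (+ 1) (+ 1) a e a′ e′)

q^-* : ∀ a e → q^ a * q^ e ≈ q^ (a ℕ.+ e)
q^-* a e = bq-* 0 a 0 e

-- geomInv k = Σ_j q^{kj} is the inverse of 1 - q^k for k ≥ 1:
-- q^k · Σ_j q^{kj} has the same coefficients as Σ_j q^{kj} from degree k on …
q^-geomInv-high : ∀ k i n → k ≤ n → (q^ k * geomInv k) i n ≡ geomInv k i n
q^-geomInv-high k i n k≤n =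
  P.trans (mono-*-in (+ 1) 0 k (geomInv k) i n z≤n k≤n)
    (P.trans (ℤP.*-identityˡ _)
      (P.cong (λ β → if does (i ℕP.≟ 0) ∧ β then + 1 else + 0)
              (does-⇔ (mk⇔ (λ k∣n-k → ∣m∸n∣n⇒∣m k k≤n k∣n-k ∣-refl)
                           (λ k∣n → ∣m+n∣m⇒∣n (P.subst (k ∣_) (P.sym (ℕP.m+[n∸m]≡n k≤n)) k∣n) ∣-refl))
                      (k ∣? (n ∸ k)) (k ∣? n))))

-- … while below degree k the geometric series is just 1
geomInv-low : ∀ k i n → 1 ≤ k → n < k → geomInv k i n ≡ oneS i n
geomInv-low k i zero    _ _ = P.cong (λ β → if does (i ℕP.≟ 0) ∧ β then + 1 else + 0) (dec-true (k ∣? 0) (k ∣0))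
geomInv-low k i (suc n) _ n<k =
  P.trans (P.cong (λ β → if does (i ℕP.≟ 0) ∧ β then + 1 else + 0)
                  (dec-false (k ∣? suc n) (λ k∣1+n → ℕP.<⇒≱ n<k (∣⇒≤ k∣1+n))))
    (P.trans (P.cong (λ β → if β then + 1 else + 0) (∧-zeroʳ (does (i ℕP.≟ 0))))
             (P.sym (mono-off₂ (+ 1) 0 0 i (suc n) (λ ()))))

geomInv-inverse : ∀ k → 1 ≤ k → geomInv k * (1# - q^ k) ≈ 1#
geomInv-inverse k 1≤k = begin
  geomInv k * (1# - q^ k)         ≈⟨ solve 2 (λ g x → g :* (con (+ 1) :- x) := g :- x :* g) refl (geomInv k) (q^ k) ⟩
  geomInv k - q^ k * geomInv k    ≈⟨ mk≋ coeff ⟩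
  1#                              ∎
  where
    coeff : (geomInv k - q^ k * geomInv k) ≈S oneS
    coeff i n with k ℕP.≤? n
    ... | yes k≤n = P.trans (P.cong (λ w → geomInv k i n ℤ.- w) (q^-geomInv-high k i n k≤n))
                      (P.trans (ℤP.+-inverseʳ (geomInv k i n))
                               (P.sym (mono-off₂ (+ 1) 0 0 i n (λ n≡0 → ℕP.<⇒≱ 1≤k (P.subst (k ≤_) n≡0 k≤n)))))
    ... | no k≰n  = P.trans (P.cong (λ w → geomInv k i n ℤ.- w) (mono-*-out₂ (+ 1) 0 k (geomInv k) i n (ℕP.≰⇒> k≰n)))
                      (P.trans (ℤP.+-identityʳ _) (geomInv-low k i n 1≤k (ℕP.≰⇒> k≰n)))

1-q^-cancel : ∀ k {x y} → 1 ≤ k → (1# - q^ k) * x ≈ (1# - q^ k) * y → x ≈ y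
1-q^-cancel k {x} {y} 1≤k e = begin
  x                                ≈⟨ sym (*-identityˡ x) ⟩
  1# * x                           ≈⟨ ⟨ sym (geomInv-inverse k 1≤k) ⟩* x ⟩
  geomInv k * (1# - q^ k) * x      ≈⟨ *-assoc (geomInv k) (1# - q^ k) x ⟩
  geomInv k * ((1# - q^ k) * x)    ≈⟨ geomInv k *⟨ e ⟩ ⟩
  geomInv k * ((1# - q^ k) * y)    ≈⟨ sym (*-assoc (geomInv k) (1# - q^ k) y) ⟩
  geomInv k * (1# - q^ k) * y      ≈⟨ ⟨ geomInv-inverse k 1≤k ⟩* y ⟩
  1# * y                           ≈⟨ *-identityˡ y ⟩
  y                                ∎

-- Gaussian polynomials: gauss (suc a) L = [a+L, L]_q, the generating function
-- Σ q^{|λ|} of the partitions λ fitting in an a × L box (λ₁ ≤ a, ℓ(λ) ≤ L);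
-- gauss 0 L = 0.  The recursion is the q-Pascal rule
-- [n, k] = [n-1, k] + q^{n-k} [n-1, k-1].
gauss : ℕ → ℕ → Series
gauss zero    L       = 0#
gauss (suc a) zero    = 1#
gauss (suc a) (suc L) = gauss a (suc L) + q^ a * gauss (suc a) L

-- only the empty partition fits in a box of width 0
gauss-1 : ∀ L → gauss 1 L ≈ 1#
gauss-1 zero    = refl
gauss-1 (suc L) = trans (+-identityˡ (1# * gauss 1 L)) (trans (*-identityˡ (gauss 1 L)) (gauss-1 L))

q^-swap : ∀ a e a′ e′ → a ℕ.+ e ≡ a′ ℕ.+ e′ → q^ a * q^ e ≈ q^ a′ * q^ e′
q^-swap a e a′ e′ eq = trans (q^-* a e) (trans (reflexive (P.cong q^ eq)) (sym (q^-* a′ e′)))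

gauss-pascal : ∀ a L → gauss (suc a) (suc L) ≈ gauss (suc a) L + q^ (suc L) * gauss a (suc L)
gauss-pascal zero L = begin
  0# + 1# * gauss 1 L           ≈⟨ trans (+-identityˡ (1# * gauss 1 L)) (*-identityˡ (gauss 1 L)) ⟩
  gauss 1 L                     ≈⟨ sym (trans (gauss 1 L +⟨ zeroʳ (q^ (suc L)) ⟩) (+-identityʳ (gauss 1 L))) ⟩
  gauss 1 L + q^ (suc L) * 0#   ∎
gauss-pascal (suc a) zero = begin
  gauss (suc a) 1 + q^ (suc a) * 1#              ≈⟨ ⟨ gauss-pascal a zero ⟩+ (q^ (suc a) * 1#) ⟩
  1# + q^ 1 * gauss a 1 + q^ (suc a) * 1#        ≈⟨ (1# + q^ 1 * gauss a 1) +⟨ ⟨ sym (q^-* 1 a) ⟩* 1# ⟩ ⟩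
  1# + q^ 1 * gauss a 1 + q^ 1 * q^ a * 1#
    ≈⟨ solve 3 (λ g x y → con (+ 1) :+ x :* g :+ x :* y :* con (+ 1) := con (+ 1) :+ x :* (g :+ y :* con (+ 1)))
             refl (gauss a 1) (q^ 1) (q^ a) ⟩
  1# + q^ 1 * (gauss a 1 + q^ a * 1#)            ∎
gauss-pascal (suc a) (suc L) = begin
  A + q^ (suc a) * gauss (suc (suc a)) (suc L)
    ≈⟨ +-cong (gauss-pascal a (suc L)) (q^ (suc a) *⟨ gauss-pascal (suc a) L ⟩) ⟩
  (B + q^ (2+ L) * C) + q^ (suc a) * (D + q^ (suc L) * B)
    ≈⟨ solve 6 (λ b c d x y z → (b :+ y :* c) :+ x :* (d :+ z :* b) := (b :+ x :* d) :+ y :* c :+ (x :* z) :* b)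
             refl B C D (q^ (suc a)) (q^ (2+ L)) (q^ (suc L)) ⟩
  (B + q^ (suc a) * D) + q^ (2+ L) * C + (q^ (suc a) * q^ (suc L)) * B
    ≈⟨ ((B + q^ (suc a) * D) + q^ (2+ L) * C) +⟨ ⟨ q^-swap (suc a) (suc L) (2+ L) a exponents ⟩* B ⟩ ⟩
  (B + q^ (suc a) * D) + q^ (2+ L) * C + (q^ (2+ L) * q^ a) * B
    ≈⟨ solve 5 (λ e c b y x → e :+ y :* c :+ (y :* x) :* b := e :+ y :* (c :+ x :* b))
             refl (B + q^ (suc a) * D) C B (q^ (2+ L)) (q^ a) ⟩
  (B + q^ (suc a) * D) + q^ (2+ L) * (C + q^ a * B) ∎
  where
    2+ : ℕ → ℕ
    2+ n = suc (suc n)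
    A = gauss (suc a) (2+ L)
    B = gauss (suc a) (suc L)
    C = gauss a (2+ L)
    D = gauss (2+ a) L
    exponents : suc a ℕ.+ suc L ≡ 2+ L ℕ.+ a
    exponents = P.cong suc (P.trans (ℕP.+-suc a L) (P.cong suc (ℕP.+-comm a L)))

gauss-ratio : ∀ a L → (1# - q^ (suc a)) * gauss (suc (suc a)) L ≈ (1# - q^ (suc a ℕ.+ L)) * gauss (suc a) L
gauss-ratio a zero    = ⟨ 1# -⟨ reflexive (P.cong q^ (P.sym (ℕP.+-identityʳ (suc a)))) ⟩ ⟩* 1#
gauss-ratio a (suc L) = begin
  (1# - q^ (suc a)) * A
    ≈⟨ solve 2 (λ a q → (con (+ 1) :- q) :* a := a :- q :* a) refl A (q^ (suc a)) ⟩
  A - q^ (suc a) * A                                   ≈⟨ A -⟨ q^ (suc a) *⟨ gauss-pascal (suc a) L ⟩ ⟩ ⟩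
  A - q^ (suc a) * (C + q^ (suc L) * B)
    ≈⟨ solve 4 (λ b c x y → (b :+ x :* c) :- x :* (c :+ y :* b) := (con (+ 1) :- x :* y) :* b)
             refl B C (q^ (suc a)) (q^ (suc L)) ⟩
  (1# - q^ (suc a) * q^ (suc L)) * B                   ≈⟨ ⟨ 1# -⟨ q^-* (suc a) (suc L) ⟩ ⟩* B ⟩
  (1# - q^ (suc a ℕ.+ suc L)) * B                      ∎
  where
    A = gauss (suc (suc a)) (suc L)
    B = gauss (suc a) (suc L)
    C = gauss (suc (suc a)) L

-- [a+L+1, L+1] = Σ_{y ≤ a} q^y [y+L, L]   (classifying by the first column)
gauss-unfold : ∀ a L → gauss (suc a) (suc L) ≈ Σ (suc a) (λ y → q^ y * gauss (suc y) L)
gauss-unfold zero    L = trans (+-identityˡ (q^ 0 * gauss 1 L)) (sym (+-identityʳ (q^ 0 * gauss 1 L)))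
gauss-unfold (suc a) L = trans (⟨ gauss-unfold a L ⟩+ (q^ (suc a) * gauss (suc (suc a)) L))
                               (sym (ΣS.Σ-last (suc a) (λ y → q^ y * gauss (suc y) L)))

when : Bool → Series → Series
when true  s = s
when false s = 0#

when-cong : ∀ c {s t} → s ≈ t → when c s ≈ when c t
when-cong true  e = e
when-cong false e = refl

when-*ˡ : ∀ c a s → when c (a * s) ≈ a * when c s
when-*ˡ true  a s = refl
when-*ˡ false a s = sym (zeroʳ a)

weight : List ℕ → Series
weight λs = bq (largestPart λs) (size λs)

boxWeight : ℕ → ℕ → Series
boxWeight a L = sumOver weight (boxPartitions a L)

sumOver-filter : ∀ xs → sumOver weight (filter (λ λs → isPartition λs BoolP.≟ true) xs)
                        ≈ sumOver (λ λs → when (isPartition λs) (weight λs)) xs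
sumOver-filter []       = refl
sumOver-filter (x ∷ xs) with isPartition x
... | true  = weight x +⟨ sumOver-filter xs ⟩
... | false = trans (sumOver-filter xs) (sym (+-identityˡ _))

sumOver-boundedLists : ∀ F a L → sumOver F (boundedLists a (suc L))
                                  ≈ F [] + Σ (suc a) (λ x → sumOver (F ∘ (x ∷_)) (boundedLists a L))
sumOver-boundedLists F a L = F [] +⟨ begin
  sumOver F (concatMap (λ x → map (x ∷_) (boundedLists a L)) (upTo (suc a)))
    ≈⟨ ΣS.sumOver-concatMap F (λ x → map (x ∷_) (boundedLists a L)) (upTo (suc a)) ⟩
  sumOver (λ x → sumOver F (map (x ∷_) (boundedLists a L))) (upTo (suc a))
    ≈⟨ reflexive (ΣS.sumOver-applyUpTo (λ x → sumOver F (map (x ∷_) (boundedLists a L))) (λ x → x) (suc a)) ⟩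
  Σ (suc a) (λ x → sumOver F (map (x ∷_) (boundedLists a L)))
    ≈⟨ ΣS.Σ-cong (suc a) {λ x → sumOver F (map (x ∷_) (boundedLists a L))} (λ x _ → reflexive (ΣS.sumOver-map F (x ∷_) (boundedLists a L))) ⟩
  Σ (suc a) (λ x → sumOver (F ∘ (x ∷_)) (boundedLists a L)) ∎ ⟩

fitsUnder : ℕ → List ℕ → Bool
fitsUnder x λs = does (largestPart λs ℕP.≤? x) ∧ isPartition λs

isPartition-∷ : ∀ x λs → isPartition (x ∷ λs) ≡ does (1 ℕP.≤? x) ∧ fitsUnder x λs
isPartition-∷ x []       = P.refl
isPartition-∷ x (y ∷ λs) = shuffle (does (y ℕP.≤? x)) (decreasing (y ∷ λs)) (does (1 ℕP.≤? x)) (allPositive (y ∷ λs))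
  where
    shuffle : ∀ a b c d → (a ∧ b) ∧ (c ∧ d) ≡ c ∧ (a ∧ (b ∧ d))
    shuffle true  b     true  d = P.refl
    shuffle true  false false d = P.refl
    shuffle true  true  false d = P.refl
    shuffle false b     true  d = P.refl
    shuffle false b     false d = P.refl

fitsUnder-∷ : ∀ x y → 1 ≤ y → y ≤ x → ∀ λs →
  when (fitsUnder x (y ∷ λs)) (q^ (size (y ∷ λs))) ≈ q^ y * when (fitsUnder y λs) (q^ (size λs))
fitsUnder-∷ x y 1≤y y≤x λs = begin
  when (does (y ℕP.≤? x) ∧ isPartition (y ∷ λs)) (q^ (y ℕ.+ size λs))
    ≈⟨ reflexive (P.cong₂ (λ β γ → when (β ∧ γ) (q^ (y ℕ.+ size λs)))
                          (dec-true (y ℕP.≤? x) y≤x)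
                          (P.trans (isPartition-∷ y λs)
                                   (P.cong (_∧ fitsUnder y λs) (dec-true (1 ℕP.≤? y) 1≤y)))) ⟩
  when (fitsUnder y λs) (q^ (y ℕ.+ size λs))       ≈⟨ when-cong (fitsUnder y λs) (sym (q^-* y (size λs))) ⟩
  when (fitsUnder y λs) (q^ y * q^ (size λs))      ≈⟨ when-*ˡ (fitsUnder y λs) (q^ y) (q^ (size λs)) ⟩
  q^ y * when (fitsUnder y λs) (q^ (size λs))      ∎

partitionsUnder : ℕ → ℕ → ℕ → Series
partitionsUnder a x L = sumOver (λ λs → when (fitsUnder x λs) (q^ (size λs))) (boundedLists a L)

partitionsUnder≈gauss : ∀ L a x → x ≤ a → partitionsUnder a x L ≈ gauss (suc x) L
partitionsUnder≈gauss zero    a x _   = +-identityʳ 1#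
partitionsUnder≈gauss (suc L) a x x≤a = begin
  partitionsUnder a x (suc L)             ≈⟨ sumOver-boundedLists F a L ⟩
  1# + (first 0 + Σ a (first ∘ suc))      ≈⟨ 1# +⟨ +-cong first-0 (ΣS.Σ-truncate a x x≤a
                                               (λ y y<x → first-in (suc y) (s≤s z≤n) y<x)
                                               (λ y x≤y → first-out (suc y) (s≤s x≤y))) ⟩ ⟩
  1# + (0# + Σ x (term ∘ suc))            ≈⟨ ⟨ sym (trans (*-identityˡ (gauss 1 L)) (gauss-1 L)) ⟩+ (0# + Σ x (term ∘ suc)) ⟩
  term 0 + (0# + Σ x (term ∘ suc))        ≈⟨ term 0 +⟨ +-identityˡ (Σ x (term ∘ suc)) ⟩ ⟩
  Σ (suc x) term                          ≈⟨ sym (gauss-unfold x L) ⟩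
  gauss (suc x) (suc L)                   ∎
  where
    F : List ℕ → Series
    F λs = when (fitsUnder x λs) (q^ (size λs))
    first : ℕ → Series
    first y = sumOver (F ∘ (y ∷_)) (boundedLists a L)
    term : ℕ → Series
    term y = q^ y * gauss (suc y) L

    first-0 : first 0 ≈ 0#
    first-0 = ΣS.sumOver-0 (F ∘ (0 ∷_)) (boundedLists a L)
      (λ λs → reflexive (P.cong (λ β → when (does (0 ℕP.≤? x) ∧ β) (q^ (size λs))) (isPartition-∷ 0 λs)))

    first-out : ∀ y → x < y → first y ≈ 0#
    first-out y x<y = ΣS.sumOver-0 (F ∘ (y ∷_)) (boundedLists a L)
      (λ λs → reflexive (P.cong (λ β → when (β ∧ isPartition (y ∷ λs)) (q^ (y ℕ.+ size λs)))
                                (dec-false (y ℕP.≤? x) (ℕP.<⇒≱ x<y))))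

    first-in : ∀ y → 1 ≤ y → y ≤ x → first y ≈ term y
    first-in y 1≤y y≤x = begin
      first y                                                     ≈⟨ ΣS.sumOver-cong (boundedLists a L) (fitsUnder-∷ x y 1≤y y≤x) ⟩
      sumOver (λ λs → q^ y * when (fitsUnder y λs) (q^ (size λs))) (boundedLists a L)
        ≈⟨ sym (ΣS.sumOver-*ˡ (q^ y) (λ λs → when (fitsUnder y λs) (q^ (size λs))) (boundedLists a L)) ⟩
      q^ y * partitionsUnder a y L                                ≈⟨ q^ y *⟨ partitionsUnder≈gauss L a y (ℕP.≤-trans y≤x x≤a) ⟩ ⟩
      term y                                                      ∎

-- Σ b^{λ₁} q^{|λ|} over the partitions with largest part exactly x and
-- at most L+1 parts: removing the first part leaves a partition in an x × L box
exactLargest : ℕ → ℕ → Series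
exactLargest L zero    = 0#
exactLargest L (suc x) = bq (suc x) (suc x) * gauss (suc (suc x)) L

firstPart≈exactLargest : ∀ a L x → x ≤ a →
  sumOver (λ λs → when (isPartition (x ∷ λs)) (weight (x ∷ λs))) (boundedLists a L) ≈ exactLargest L x
firstPart≈exactLargest a L zero _ = ΣS.sumOver-0 (λ λs → when (isPartition (0 ∷ λs)) (weight (0 ∷ λs))) (boundedLists a L)
  (λ λs → reflexive (P.cong (λ β → when β (weight (0 ∷ λs))) (isPartition-∷ 0 λs)))
firstPart≈exactLargest a L (suc x) x<a = begin
  sumOver (λ λs → when (isPartition (suc x ∷ λs)) (weight (suc x ∷ λs))) (boundedLists a L)
    ≈⟨ ΣS.sumOver-cong (boundedLists a L) summand ⟩
  sumOver (λ λs → bq (suc x) (suc x) * when (fitsUnder (suc x) λs) (q^ (size λs))) (boundedLists a L)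
    ≈⟨ sym (ΣS.sumOver-*ˡ (bq (suc x) (suc x)) (λ λs → when (fitsUnder (suc x) λs) (q^ (size λs))) (boundedLists a L)) ⟩
  bq (suc x) (suc x) * partitionsUnder a (suc x) L
    ≈⟨ bq (suc x) (suc x) *⟨ partitionsUnder≈gauss L a (suc x) x<a ⟩ ⟩
  exactLargest L (suc x) ∎
  where
    summand : ∀ λs → when (isPartition (suc x ∷ λs)) (weight (suc x ∷ λs))
                     ≈ bq (suc x) (suc x) * when (fitsUnder (suc x) λs) (q^ (size λs))
    summand λs = begin
      when (isPartition (suc x ∷ λs)) (bq (suc x) (suc x ℕ.+ size λs))
        ≈⟨ reflexive (P.cong (λ β → when β (bq (suc x) (suc x ℕ.+ size λs))) (isPartition-∷ (suc x) λs)) ⟩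
      when (fitsUnder (suc x) λs) (bq (suc x) (suc x ℕ.+ size λs))
        ≈⟨ when-cong (fitsUnder (suc x) λs)
             (sym (trans (bq-* (suc x) (suc x) 0 (size λs))
                         (reflexive (P.cong (λ w → bq w (suc x ℕ.+ size λs)) (ℕP.+-identityʳ (suc x)))))) ⟩
      when (fitsUnder (suc x) λs) (bq (suc x) (suc x) * q^ (size λs))
        ≈⟨ when-*ˡ (fitsUnder (suc x) λs) (bq (suc x) (suc x)) (q^ (size λs)) ⟩
      bq (suc x) (suc x) * when (fitsUnder (suc x) λs) (q^ (size λs)) ∎

boxWeight-byLargest : ∀ a L → boxWeight a (suc L) ≈ 1# + Σ (suc a) (exactLargest L)
boxWeight-byLargest a L = begin
  boxWeight a (suc L)
    ≈⟨ sumOver-filter (boundedLists a (suc L)) ⟩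
  sumOver (λ λs → when (isPartition λs) (weight λs)) (boundedLists a (suc L))
    ≈⟨ sumOver-boundedLists (λ λs → when (isPartition λs) (weight λs)) a L ⟩
  1# + Σ (suc a) (λ x → sumOver (λ λs → when (isPartition (x ∷ λs)) (weight (x ∷ λs))) (boundedLists a L))
    ≈⟨ 1# +⟨ ΣS.Σ-cong (suc a) (λ x x≤a → firstPart≈exactLargest a L x (ℕP.≤-pred x≤a)) ⟩ ⟩
  1# + Σ (suc a) (exactLargest L) ∎

boxWeight-width0 : ∀ L → boxWeight 0 L ≈ 1#
boxWeight-width0 zero    = +-identityʳ 1#
boxWeight-width0 (suc L) = trans (boxWeight-byLargest 0 L) (trans (1# +⟨ +-identityʳ 0# ⟩) (+-identityʳ 1#))

boxWeight-widen : ∀ a L → boxWeight (suc a) (suc L) ≈ boxWeight a (suc L) + exactLargest L (suc a)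
boxWeight-widen a L = begin
  boxWeight (suc a) (suc L)                                   ≈⟨ boxWeight-byLargest (suc a) L ⟩
  1# + Σ (suc (suc a)) (exactLargest L)                       ≈⟨ 1# +⟨ ΣS.Σ-last (suc a) (exactLargest L) ⟩ ⟩
  1# + (Σ (suc a) (exactLargest L) + exactLargest L (suc a))  ≈⟨ sym (+-assoc 1# (Σ (suc a) (exactLargest L)) (exactLargest L (suc a))) ⟩
  1# + Σ (suc a) (exactLargest L) + exactLargest L (suc a)    ≈⟨ ⟨ sym (boxWeight-byLargest a L) ⟩+ exactLargest L (suc a) ⟩
  boxWeight a (suc L) + exactLargest L (suc a)                ∎

choose2 : ℕ → ℕ
choose2 zero    = 0
choose2 (suc j) = choose2 j ℕ.+ j

z : ℕ → Series
z k = q^ k * geomInv k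

altSign : ℕ → Series
altSign j = signS j * q^ (choose2 j)

altTerm : ℕ → ℕ → ℕ → Series
altTerm m s j = altSign j * (z (suc j) ^S m) * gauss (s ∸ j) j

alt : ℕ → ℕ → Series
alt m s = Σ s (altTerm m s)

1+[n∸1+m] : ∀ {n m} → m < n → n ∸ m ≡ suc (n ∸ suc m)
1+[n∸1+m] {n} {m} m<n = ℕP.+-∸-assoc 1 m<n

-- By the other q-Pascal rule each summand of alt 0 (N+1) but the first is
-- a difference of consecutive values of
--   telescoping N i = (-1)^{i+1} q^{C(i+1,2)} [N-1, i]_q.
telescoping : ℕ → ℕ → Series
telescoping N i = altSign (suc i) * gauss (N ∸ i) i

altTerm0-telescopes : ∀ N i → i < N → altTerm 0 (suc N) (suc i) ≈ telescoping N i - telescoping N (suc i)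
altTerm0-telescopes N i i<N = begin
  S * Q * 1# * gauss (N ∸ i) (suc i)
    ≈⟨ (S * Q * 1#) *⟨ reflexive (P.cong (λ w → gauss w (suc i)) (1+[n∸1+m] i<N)) ⟩ ⟩
  S * Q * 1# * gauss (suc a) (suc i)                         ≈⟨ (S * Q * 1#) *⟨ gauss-pascal a i ⟩ ⟩
  S * Q * 1# * (gauss (suc a) i + q^ (suc i) * gauss a (suc i))
    ≈⟨ solve 5 (λ s q g x g′ → s :* q :* con (+ 1) :* (g :+ x :* g′) := s :* q :* g :- (:- s) :* (q :* x) :* g′)
             refl S Q (gauss (suc a) i) (q^ (suc i)) (gauss a (suc i)) ⟩
  S * Q * gauss (suc a) i - (- S) * (Q * q^ (suc i)) * gauss a (suc i)
    ≈⟨ +-cong ((S * Q) *⟨ reflexive (P.cong (λ w → gauss w i) (P.sym (1+[n∸1+m] i<N))) ⟩)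
              (-‿cong (⟨ (- S) *⟨ q^-* (choose2 (suc i)) (suc i) ⟩ ⟩* gauss a (suc i))) ⟩
  telescoping N i - telescoping N (suc i) ∎
  where
    a = N ∸ suc i
    S = signS (suc i)
    Q = q^ (choose2 (suc i))

-- For m = 0 this is the q-binomial theorem at x = 1:
--   Σ_j (-1)^j q^{C(j,2)} [n, j]_q = 0  for n ≥ 1.
alt-0 : ∀ n → alt 0 (suc (suc n)) ≈ 0#
alt-0 n = begin
  altTerm 0 (suc N) 0 + Σ N (altTerm 0 (suc N) ∘ suc)
    ≈⟨ altTerm 0 (suc N) 0 +⟨ ΣS.Σ-cong N (altTerm0-telescopes N) ⟩ ⟩
  altTerm 0 (suc N) 0 + Σ N (λ i → T i - T (suc i))   ≈⟨ altTerm 0 (suc N) 0 +⟨ ΣS.telescope N T ⟩ ⟩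
  altTerm 0 (suc N) 0 + (T 0 - T N)
    ≈⟨ altTerm 0 (suc N) 0 +⟨ T 0 -⟨ reflexive (P.cong (λ w → X * gauss w N) (ℕP.n∸n≡0 N)) ⟩ ⟩ ⟩
  1# * 1# * 1# * 1# + (- 1# * 1# * 1# - X * 0#)
    ≈⟨ solve 2 (λ x w → con (+ 1) :* con (+ 1) :* con (+ 1) :* con (+ 1)
                         :+ (:- con (+ 1) :* con (+ 1) :* con (+ 1) :- x :* w) := (:- x) :* w) refl X 0# ⟩
  (- X) * 0#                                           ≈⟨ zeroʳ (- X) ⟩
  0#                                                   ∎
  where
    N = suc n
    X = altSign (suc N)
    T = telescoping N

z-shift : ∀ k d → 1 ≤ k → (1# - q^ (k ℕ.+ d)) * z k - q^ (k ℕ.+ d) ≈ z k * (1# - q^ d)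
z-shift k d 1≤k = begin
  (1# - q^ (k ℕ.+ d)) * z k - q^ (k ℕ.+ d)
    ≈⟨ +-cong (⟨ 1# -⟨ split ⟩ ⟩* z k) (-‿cong (trans split (sym (*-identityʳ (q^ k * q^ d))))) ⟩
  (1# - q^ k * q^ d) * (q^ k * geomInv k) - q^ k * q^ d * 1#
    ≈⟨ ((1# - q^ k * q^ d) * (q^ k * geomInv k)) -⟨ (q^ k * q^ d) *⟨ sym (geomInv-inverse k 1≤k) ⟩ ⟩ ⟩
  (1# - q^ k * q^ d) * (q^ k * geomInv k) - q^ k * q^ d * (geomInv k * (1# - q^ k))
    ≈⟨ solve 3 (λ a b g → (con (+ 1) :- a :* b) :* (a :* g) :- a :* b :* (g :* (con (+ 1) :- a))
                          := (a :* g) :* (con (+ 1) :- b)) refl (q^ k) (q^ d) (geomInv k) ⟩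
  z k * (1# - q^ d) ∎
  where
    split : q^ (k ℕ.+ d) ≈ q^ k * q^ d
    split = sym (q^-* k d)

altTerm-rec : ∀ m s j → j ≤ s →
  (1# - q^ (suc s)) * altTerm (suc m) (suc s) j - q^ (suc s) * altTerm m (suc s) j
    ≈ altSign j * (z (suc j) ^S suc m) * ((1# - q^ (s ∸ j)) * gauss (suc s ∸ j) j)
altTerm-rec m s j j≤s = begin
  (1# - q^ (suc s)) * (altSign j * (zj * zjᵐ) * G) - q^ (suc s) * (altSign j * zjᵐ * G)
    ≈⟨ solve 5 (λ a x u v g → (con (+ 1) :- a) :* (x :* (u :* v) :* g) :- a :* (x :* v :* g)
                              := x :* v :* g :* ((con (+ 1) :- a) :* u :- a))
             refl (q^ (suc s)) (altSign j) zj zjᵐ G ⟩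
  altSign j * zjᵐ * G * ((1# - q^ (suc s)) * zj - q^ (suc s))
    ≈⟨ (altSign j * zjᵐ * G) *⟨ trans (+-cong (⟨ 1# -⟨ s+1≡ ⟩ ⟩* zj) (-‿cong s+1≡)) (z-shift (suc j) (s ∸ j) (s≤s z≤n)) ⟩ ⟩
  altSign j * zjᵐ * G * (zj * (1# - q^ (s ∸ j)))
    ≈⟨ solve 5 (λ x v g u w → x :* v :* g :* (u :* w) := x :* (u :* v) :* (w :* g))
             refl (altSign j) zjᵐ G zj (1# - q^ (s ∸ j)) ⟩
  altSign j * (zj * zjᵐ) * ((1# - q^ (s ∸ j)) * G) ∎
  where
    zj  = z (suc j)
    zjᵐ = z (suc j) ^S m
    G   = gauss (suc s ∸ j) j
    s+1≡ : q^ (suc s) ≈ q^ (suc j ℕ.+ (s ∸ j))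
    s+1≡ = reflexive (P.cong (q^ ∘ suc) (P.sym (ℕP.m+[n∸m]≡n j≤s)))

gauss-ratio′ : ∀ s j → j < s → (1# - q^ (s ∸ j)) * gauss (suc s ∸ j) j ≈ (1# - q^ s) * gauss (s ∸ j) j
gauss-ratio′ s j j<s = begin
  (1# - q^ (s ∸ j)) * gauss (suc s ∸ j) j
    ≈⟨ reflexive (P.cong₂ (λ u v → (1# - q^ u) * gauss v j) (1+[n∸1+m] j<s)
                          (P.trans (ℕP.+-∸-assoc 1 (ℕP.<⇒≤ j<s)) (P.cong suc (1+[n∸1+m] j<s)))) ⟩
  (1# - q^ (suc a)) * gauss (suc (suc a)) j      ≈⟨ gauss-ratio a j ⟩
  (1# - q^ (suc a ℕ.+ j)) * gauss (suc a) j
    ≈⟨ reflexive (P.cong₂ (λ u v → (1# - q^ u) * gauss v j) a+1+j≡s (P.sym (1+[n∸1+m] j<s))) ⟩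
  (1# - q^ s) * gauss (s ∸ j) j                  ∎
  where
    a = s ∸ suc j
    a+1+j≡s : suc a ℕ.+ j ≡ s
    a+1+j≡s = P.trans (P.cong (ℕ._+ j) (P.sym (1+[n∸1+m] j<s))) (ℕP.m∸n+n≡m (ℕP.<⇒≤ j<s))

alt-rec : ∀ m s → (1# - q^ (suc s)) * alt (suc m) (suc s) - q^ (suc s) * alt m (suc s) ≈ (1# - q^ s) * alt (suc m) s
alt-rec m s = begin
  (1# - q^ (suc s)) * alt (suc m) (suc s) - q^ (suc s) * alt m (suc s)
    ≈⟨ ΣS.Σ-linear (suc s) (1# - q^ (suc s)) (q^ (suc s)) (altTerm (suc m) (suc s)) (altTerm m (suc s)) ⟩
  Σ (suc s) (λ j → (1# - q^ (suc s)) * altTerm (suc m) (suc s) j - q^ (suc s) * altTerm m (suc s) j)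
    ≈⟨ ΣS.Σ-cong (suc s) (λ j j≤s → altTerm-rec m s j (ℕP.≤-pred j≤s)) ⟩
  Σ (suc s) R                                              ≈⟨ ΣS.Σ-last s R ⟩
  Σ s R + R s                                              ≈⟨ +-cong (ΣS.Σ-cong s R-below) R-top ⟩
  Σ s (λ j → (1# - q^ s) * altTerm (suc m) s j) + 0#        ≈⟨ +-identityʳ _ ⟩
  Σ s (λ j → (1# - q^ s) * altTerm (suc m) s j)             ≈⟨ sym (ΣS.Σ-*ˡ s (1# - q^ s) (altTerm (suc m) s)) ⟩
  (1# - q^ s) * alt (suc m) s                              ∎
  where
    R : ℕ → Series
    R j = altSign j * (z (suc j) ^S suc m) * ((1# - q^ (s ∸ j)) * gauss (suc s ∸ j) j)
    R-below : ∀ j → j < s → R j ≈ (1# - q^ s) * altTerm (suc m) s j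
    R-below j j<s = trans ((altSign j * (z (suc j) ^S suc m)) *⟨ gauss-ratio′ s j j<s ⟩)
      (solve 3 (λ x a g → x :* (a :* g) := a :* (x :* g)) refl
             (altSign j * (z (suc j) ^S suc m)) (1# - q^ s) (gauss (s ∸ j) j))
    -- the top summand carries the factor 1 - q^0 = 0
    R-top : R s ≈ 0#
    R-top = begin
      Y * ((1# - q^ (s ∸ s)) * G)    ≈⟨ Y *⟨ ⟨ 1# -⟨ reflexive (P.cong q^ (ℕP.n∸n≡0 s)) ⟩ ⟩* G ⟩ ⟩
      Y * ((1# - 1#) * G)            ≈⟨ Y *⟨ ⟨ -‿inverseʳ 1# ⟩* G ⟩ ⟩
      Y * (0# * G)                   ≈⟨ Y *⟨ zeroˡ G ⟩ ⟩
      Y * 0#                         ≈⟨ zeroʳ Y ⟩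
      0#                             ∎
      where
        Y = altSign s * (z (suc s) ^S suc m)
        G = gauss (suc s ∸ s) s

ΣS-range1 : ∀ N (F : ℕ → Series) → ΣS (range1 N) F ≈ Σ N (F ∘ suc)
ΣS-range1 N F = reflexive (P.trans (ΣS.sumOver-map F suc (upTo N)) (ΣS.sumOver-applyUpTo (F ∘ suc) (λ x → x) N))

nested-1 : ∀ r → nested r 1 ≈ z 1 ^S r
nested-1 zero    = refl
nested-1 (suc r) = trans (+-identityʳ _) ((q^ 1 * geomInv 1) *⟨ nested-1 r ⟩)

nested-rec : ∀ r s → nested (suc r) (suc s) ≈ nested (suc r) s + z (suc s) * nested r (suc s)
nested-rec r s = begin
  nested (suc r) (suc s)       ≈⟨ ΣS-range1 (suc s) F ⟩
  Σ (suc s) (F ∘ suc)          ≈⟨ ΣS.Σ-last s (F ∘ suc) ⟩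
  Σ s (F ∘ suc) + F (suc s)    ≈⟨ ⟨ sym (ΣS-range1 s F) ⟩+ F (suc s) ⟩
  nested (suc r) s + F (suc s) ∎
  where
    F : ℕ → Series
    F i = q^ i * geomInv i * nested r i

closed : ℕ → ℕ → Series
closed m s = q^ 1 * geomInv s * nested m s

1-q^-closed : ∀ m s → 1 ≤ s → (1# - q^ s) * closed m s ≈ q^ 1 * nested m s
1-q^-closed m s 1≤s = begin
  (1# - q^ s) * (q^ 1 * geomInv s * nested m s)
    ≈⟨ solve 4 (λ x a g n → (con (+ 1) :- x) :* (a :* g :* n) := a :* n :* (g :* (con (+ 1) :- x)))
             refl (q^ s) (q^ 1) (geomInv s) (nested m s) ⟩
  q^ 1 * nested m s * (geomInv s * (1# - q^ s)) ≈⟨ (q^ 1 * nested m s) *⟨ geomInv-inverse s 1≤s ⟩ ⟩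
  q^ 1 * nested m s * 1#                        ≈⟨ *-identityʳ _ ⟩
  q^ 1 * nested m s                             ∎

-- One step of the induction for  alt (m+1) s = closed m s: given it at s+1
-- and given alt m (s+2), it follows at s+2 from alt-rec after cancelling
-- 1 - q^{s+2}; the hypothesis `tail` is the remaining identity on nested sums.
alt-closed-step : ∀ s m Y → alt m (suc (suc s)) ≈ Y →
  q^ 1 * nested m (suc s) + q^ (suc (suc s)) * Y ≈ q^ 1 * nested m (suc (suc s)) →
  alt (suc m) (suc s) ≈ closed m (suc s) → alt (suc m) (suc (suc s)) ≈ closed m (suc (suc s))
alt-closed-step s m Y alt-m tail IH = 1-q^-cancel S (s≤s z≤n) (begin
  (1# - q^ S) * alt (suc m) S
    ≈⟨ solve 2 (λ x y → x := (x :- y) :+ y) refl ((1# - q^ S) * alt (suc m) S) (q^ S * alt m S) ⟩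
  ((1# - q^ S) * alt (suc m) S - q^ S * alt m S) + q^ S * alt m S
    ≈⟨ +-cong (alt-rec m (suc s)) (q^ S *⟨ alt-m ⟩) ⟩
  (1# - q^ (suc s)) * alt (suc m) (suc s) + q^ S * Y
    ≈⟨ ⟨ trans ((1# - q^ (suc s)) *⟨ IH ⟩) (1-q^-closed m (suc s) (s≤s z≤n)) ⟩+ (q^ S * Y) ⟩
  q^ 1 * nested m (suc s) + q^ S * Y           ≈⟨ tail ⟩
  q^ 1 * nested m S                            ≈⟨ sym (1-q^-closed m S (s≤s z≤n)) ⟩
  (1# - q^ S) * closed m S                     ∎)
  where S = suc (suc s)

alt-closed : ∀ s m → alt (suc m) (suc s) ≈ closed m (suc s)
alt-closed zero m = begin
  1# * 1# * (z 1 * (z 1 ^S m)) * 1# + 0#   ≈⟨ +-identityʳ _ ⟩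
  1# * 1# * (z 1 * (z 1 ^S m)) * 1#
    ≈⟨ solve 3 (λ a g w → con (+ 1) :* con (+ 1) :* ((a :* g) :* w) :* con (+ 1) := a :* g :* w)
             refl (q^ 1) (geomInv 1) (z 1 ^S m) ⟩
  q^ 1 * geomInv 1 * (z 1 ^S m)            ≈⟨ (q^ 1 * geomInv 1) *⟨ sym (nested-1 m) ⟩ ⟩
  closed m 1                               ∎
alt-closed (suc s) zero = alt-closed-step s 0 0# (alt-0 s) tail (alt-closed s 0)
  where
    tail : q^ 1 * 1# + q^ (suc (suc s)) * 0# ≈ q^ 1 * 1#
    tail = trans ((q^ 1 * 1#) +⟨ zeroʳ (q^ (suc (suc s))) ⟩) (+-identityʳ _)
alt-closed (suc s) (suc m) =
  alt-closed-step s (suc m) (closed m S) (alt-closed (suc s) m) tail (alt-closed s (suc m))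
  where
    S = suc (suc s)
    tail : q^ 1 * nested (suc m) (suc s) + q^ S * closed m S ≈ q^ 1 * nested (suc m) S
    tail = begin
      q^ 1 * nested (suc m) (suc s) + q^ S * (q^ 1 * geomInv S * nested m S)
        ≈⟨ solve 5 (λ a n x g n′ → a :* n :+ x :* (a :* g :* n′) := a :* (n :+ x :* g :* n′))
                 refl (q^ 1) (nested (suc m) (suc s)) (q^ S) (geomInv S) (nested m S) ⟩
      q^ 1 * (nested (suc m) (suc s) + q^ S * geomInv S * nested m S)
        ≈⟨ q^ 1 *⟨ sym (nested-rec m (suc s)) ⟩ ⟩
      q^ 1 * nested (suc m) S ∎

tri≡choose2 : ∀ k → tri k ≡ choose2 (suc k)
tri≡choose2 k = P.trans (P.cong (ℕ._/ 2) (P.sym (double k))) (m*n/n≡m (choose2 (suc k)) 2)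
  where
    double : ∀ k → choose2 (suc k) ℕ.* 2 ≡ k ℕ.* suc k
    double zero    = P.refl
    double (suc k) = P.trans (ℕP.*-distribʳ-+ 2 (choose2 (suc k)) (suc k))
                             (P.trans (P.cong (ℕ._+ suc k ℕ.* 2) (double k)) (step k))
      where
        step : ∀ k → k ℕ.* suc k ℕ.+ suc k ℕ.* 2 ≡ suc k ℕ.* suc (suc k)
        step = solve-∀

z^ : ∀ k m → z k ^S m ≈ q^ (m ℕ.* k) * (geomInv k ^S m)
z^ k zero    = sym (*-identityˡ 1#)
z^ k (suc m) = begin
  z k * (z k ^S m)                                      ≈⟨ z k *⟨ z^ k m ⟩ ⟩
  (q^ k * geomInv k) * (q^ (m ℕ.* k) * (geomInv k ^S m))
    ≈⟨ solve 4 (λ a b c d → (a :* b) :* (c :* d) := (a :* c) :* (b :* d))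
             refl (q^ k) (geomInv k) (q^ (m ℕ.* k)) (geomInv k ^S m) ⟩
  (q^ k * q^ (m ℕ.* k)) * (geomInv k * (geomInv k ^S m)) ≈⟨ ⟨ q^-* k (m ℕ.* k) ⟩* (geomInv k * (geomInv k ^S m)) ⟩
  q^ (suc m ℕ.* k) * (geomInv k ^S suc m)               ∎

-- The left-hand side, summand by summand (k = j + 1).
lhsCoeff : ℕ → ℕ → Series
lhsCoeff m j = signS j * bq (suc j) (tri (suc j) ℕ.+ (m ∸ 1) ℕ.* suc j) * (geomInv (suc j) ^S m)

lhsTerm : ℕ → ℕ → ℕ → Series
lhsTerm m t j = lhsCoeff m j * boxWeight (t ∸ suc j) (suc j)

LHS≈Σ : ∀ m t → LHS m t ≈ Σ t (lhsTerm m t)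
LHS≈Σ m t = ΣS-range1 t (λ k → signS (k ∸ 1) *S bq k (tri k ℕ.+ (m ∸ 1) ℕ.* k) *S (geomInv k ^S m) *S qbBinom t k)

-- passing from t to t+1 enlarges each box by one column; the new
-- partitions are those with largest part t - j
lhsDiff : ℕ → ℕ → ℕ → Series
lhsDiff m t j = lhsCoeff m j * (bq (t ∸ j) (t ∸ j) * gauss (suc (t ∸ j)) j)

lhsTerm-suc : ∀ m t j → j < t → lhsTerm m (suc t) j ≈ lhsTerm m t j + lhsDiff m t j
lhsTerm-suc m t j j<t = begin
  lhsCoeff m j * boxWeight (t ∸ j) (suc j)
    ≈⟨ lhsCoeff m j *⟨ reflexive (P.cong (λ w → boxWeight w (suc j)) (1+[n∸1+m] j<t)) ⟩ ⟩
  lhsCoeff m j * boxWeight (suc a) (suc j)                   ≈⟨ lhsCoeff m j *⟨ boxWeight-widen a j ⟩ ⟩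
  lhsCoeff m j * (boxWeight a (suc j) + exactLargest j (suc a))
    ≈⟨ distribˡ (lhsCoeff m j) (boxWeight a (suc j)) (exactLargest j (suc a)) ⟩
  lhsTerm m t j + lhsCoeff m j * exactLargest j (suc a)
    ≈⟨ lhsTerm m t j +⟨ lhsCoeff m j *⟨ reflexive (P.cong (λ w → bq w w * gauss (suc w) j) (P.sym (1+[n∸1+m] j<t))) ⟩ ⟩ ⟩
  lhsTerm m t j + lhsDiff m t j                              ∎
  where a = t ∸ suc j

-- the summand with k = t+1 is new; its box has width 0
lhsTerm-new : ∀ m t → lhsTerm m (suc t) t ≈ lhsDiff m t t
lhsTerm-new m t = begin
  lhsCoeff m t * boxWeight (t ∸ t) (suc t)
    ≈⟨ lhsCoeff m t *⟨ reflexive (P.cong (λ w → boxWeight w (suc t)) (ℕP.n∸n≡0 t)) ⟩ ⟩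
  lhsCoeff m t * boxWeight 0 (suc t)         ≈⟨ lhsCoeff m t *⟨ boxWeight-width0 (suc t) ⟩ ⟩
  lhsCoeff m t * 1#                          ≈⟨ lhsCoeff m t *⟨ sym (trans (*-identityˡ (gauss 1 t)) (gauss-1 t)) ⟩ ⟩
  lhsCoeff m t * (bq 0 0 * gauss 1 t)
    ≈⟨ lhsCoeff m t *⟨ reflexive (P.cong (λ w → bq w w * gauss (suc w) t) (P.sym (ℕP.n∸n≡0 t))) ⟩ ⟩
  lhsDiff m t t                              ∎

lhs-suc : ∀ m t → Σ (suc t) (lhsTerm m (suc t)) ≈ Σ t (lhsTerm m t) + Σ (suc t) (lhsDiff m t)
lhs-suc m t = begin
  Σ (suc t) (lhsTerm m (suc t))                        ≈⟨ ΣS.Σ-last t (lhsTerm m (suc t)) ⟩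
  Σ t (lhsTerm m (suc t)) + lhsTerm m (suc t) t        ≈⟨ +-cong (ΣS.Σ-cong t (lhsTerm-suc m t)) (lhsTerm-new m t) ⟩
  Σ t (λ j → lhsTerm m t j + lhsDiff m t j) + lhsDiff m t t
    ≈⟨ ⟨ ΣS.Σ-+ t (lhsTerm m t) (lhsDiff m t) ⟩+ lhsDiff m t t ⟩
  Σ t (lhsTerm m t) + Σ t (lhsDiff m t) + lhsDiff m t t
    ≈⟨ +-assoc (Σ t (lhsTerm m t)) (Σ t (lhsDiff m t)) (lhsDiff m t t) ⟩
  Σ t (lhsTerm m t) + (Σ t (lhsDiff m t) + lhsDiff m t t) ≈⟨ Σ t (lhsTerm m t) +⟨ sym (ΣS.Σ-last t (lhsDiff m t)) ⟩ ⟩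
  Σ t (lhsTerm m t) + Σ (suc t) (lhsDiff m t)             ∎

lhsDiff-exponent : ∀ m′ t j → j ≤ t →
  (tri (suc j) ℕ.+ m′ ℕ.* suc j) ℕ.+ (t ∸ j) ≡ t ℕ.+ (choose2 j ℕ.+ suc m′ ℕ.* suc j)
lhsDiff-exponent m′ t j j≤t =
  P.trans (P.cong (λ w → w ℕ.+ m′ ℕ.* suc j ℕ.+ (t ∸ j)) (tri≡choose2 (suc j)))
    (P.trans (regroup (choose2 j) j m′ (t ∸ j))
             (P.cong (ℕ._+ (choose2 j ℕ.+ suc m′ ℕ.* suc j)) (ℕP.m∸n+n≡m j≤t)))
  where
    regroup : ∀ c j m′ d → ((c ℕ.+ j) ℕ.+ suc j) ℕ.+ m′ ℕ.* suc j ℕ.+ d ≡ (d ℕ.+ j) ℕ.+ (c ℕ.+ suc m′ ℕ.* suc j)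
    regroup = solve-∀

lhsDiff≈altTerm : ∀ m′ t j → j ≤ t → lhsDiff (suc m′) t j ≈ bq (suc t) t * altTerm (suc m′) (suc t) j
lhsDiff≈altTerm m′ t j j≤t = begin
  signS j * B * Gᵐ * (bq d d * G)
    ≈⟨ solve 5 (λ s b g b′ p → s :* b :* g :* (b′ :* p) := (b :* b′) :* (s :* g :* p))
             refl (signS j) B Gᵐ (bq d d) G ⟩
  (B * bq d d) * (signS j * Gᵐ * G)
    ≈⟨ ⟨ trans (bq-* (suc j) E d d) (reflexive (P.cong₂ bq b-exponent (lhsDiff-exponent m′ t j j≤t))) ⟩* (signS j * Gᵐ * G) ⟩
  bq (suc t ℕ.+ 0) (t ℕ.+ (choose2 j ℕ.+ suc m′ ℕ.* suc j)) * (signS j * Gᵐ * G)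
    ≈⟨ ⟨ sym (trans (bq (suc t) t *⟨ q^-* (choose2 j) (suc m′ ℕ.* suc j) ⟩)
                    (bq-* (suc t) t 0 (choose2 j ℕ.+ suc m′ ℕ.* suc j))) ⟩* (signS j * Gᵐ * G) ⟩
  (bq (suc t) t * (q^ (choose2 j) * q^ (suc m′ ℕ.* suc j))) * (signS j * Gᵐ * G)
    ≈⟨ solve 6 (λ b x y s g p → (b :* (x :* y)) :* (s :* g :* p) := b :* (s :* x :* (y :* g) :* p))
             refl (bq (suc t) t) (q^ (choose2 j)) (q^ (suc m′ ℕ.* suc j)) (signS j) Gᵐ G ⟩
  bq (suc t) t * (altSign j * (q^ (suc m′ ℕ.* suc j) * Gᵐ) * G)
    ≈⟨ bq (suc t) t *⟨ *-cong (altSign j *⟨ sym (z^ (suc j) (suc m′)) ⟩)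
                              (reflexive (P.cong (λ w → gauss w j) (P.sym (ℕP.+-∸-assoc 1 j≤t)))) ⟩ ⟩
  bq (suc t) t * altTerm (suc m′) (suc t) j ∎
  where
    d  = t ∸ j
    E  = tri (suc j) ℕ.+ m′ ℕ.* suc j
    B  = bq (suc j) E
    Gᵐ = geomInv (suc j) ^S suc m′
    G  = gauss (suc d) j
    b-exponent : suc j ℕ.+ d ≡ suc t ℕ.+ 0
    b-exponent = P.trans (P.cong suc (ℕP.m+[n∸m]≡n j≤t)) (P.sym (ℕP.+-identityʳ (suc t)))

rhsTerm : ℕ → ℕ → Series
rhsTerm m′ j = bq (suc j) (suc j) * geomInv (suc j) * nested m′ (suc j)

RHS≈Σ : ∀ m′ t → RHS (suc m′) t ≈ Σ t (rhsTerm m′)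
RHS≈Σ m′ t = ΣS-range1 t (λ j₁ → bq j₁ j₁ *S geomInv j₁ *S nested m′ j₁)

lhsDiff-sum : ∀ m′ t → Σ (suc t) (lhsDiff (suc m′) t) ≈ rhsTerm m′ t
lhsDiff-sum m′ t = begin
  Σ (suc t) (lhsDiff (suc m′) t)
    ≈⟨ ΣS.Σ-cong (suc t) (λ j j≤t → lhsDiff≈altTerm m′ t j (ℕP.≤-pred j≤t)) ⟩
  Σ (suc t) (λ j → bq (suc t) t * altTerm (suc m′) (suc t) j)
    ≈⟨ sym (ΣS.Σ-*ˡ (suc t) (bq (suc t) t) (altTerm (suc m′) (suc t))) ⟩
  bq (suc t) t * alt (suc m′) (suc t)            ≈⟨ bq (suc t) t *⟨ alt-closed t m′ ⟩ ⟩
  bq (suc t) t * (q^ 1 * geomInv (suc t) * nested m′ (suc t))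
    ≈⟨ solve 4 (λ b x g n → b :* (x :* g :* n) := (b :* x) :* g :* n)
             refl (bq (suc t) t) (q^ 1) (geomInv (suc t)) (nested m′ (suc t)) ⟩
  bq (suc t) t * q^ 1 * geomInv (suc t) * nested m′ (suc t)
    ≈⟨ ⟨ ⟨ trans (bq-* (suc t) t 0 1) (reflexive (P.cong₂ bq (ℕP.+-identityʳ (suc t)) (ℕP.+-comm t 1)))
         ⟩* geomInv (suc t) ⟩* nested m′ (suc t) ⟩
  rhsTerm m′ t                                   ∎

LHS≈RHS : ∀ m′ t → LHS (suc m′) t ≈ RHS (suc m′) t
LHS≈RHS m′ zero    = refl
LHS≈RHS m′ (suc t) = begin
  LHS (suc m′) (suc t)                                     ≈⟨ LHS≈Σ (suc m′) (suc t) ⟩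
  Σ (suc t) (lhsTerm (suc m′) (suc t))                     ≈⟨ lhs-suc (suc m′) t ⟩
  Σ t (lhsTerm (suc m′) t) + Σ (suc t) (lhsDiff (suc m′) t)
    ≈⟨ +-cong (trans (sym (LHS≈Σ (suc m′) t)) (trans (LHS≈RHS m′ t) (RHS≈Σ m′ t))) (lhsDiff-sum m′ t) ⟩
  Σ t (rhsTerm m′) + rhsTerm m′ t                          ≈⟨ sym (ΣS.Σ-last t (rhsTerm m′)) ⟩
  Σ (suc t) (rhsTerm m′)                                   ≈⟨ sym (RHS≈Σ m′ (suc t)) ⟩
  RHS (suc m′) (suc t)                                     ∎

-- the theorem
theorem4p5 : (m t : ℕ) → 1 ≤ m → 1 ≤ t → LHS m t ≈S RHS m t
theorem4p5 (suc m′) t _ _ = get (LHS≈RHS m′ t)
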